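{- Let $R$ be a consistent triple set and $ab|c,\ a'b'|c'\in\mathrm{cl}(R)$. Suppose $\{A,B\}\in\mathfrak L(ab|c;R)$ and $\{A',B'\}\in\mathfrak L(a'b'|c';R)$. If $A\cap A'\ne\emptyset$ and $B\cap B'\ne\emptyset$, then $\{A\cup A',B\cup B'\}\in\mathfrak L(ab|c;R)\cap\mathfrak L(a'b'|c';R)$.
   Context: A rooted tree $T$ has a distinguished inner vertex (root); leaves are degree-1 vertices; inner vertices other than the root have degree at least 3. A triple $ab|c$ is the rooted binary tree on leaves $a,b,c$ where the path from $a$ to $b$ avoids the path from $c$ to the root; $ab|c=ba|c$. A rooted tree displays $ab|c$ if $a,b,c$ are leaves and the path from $a$ to $b$ does not intersect the path from $c$ to the root; $\mathcal R(T)$ is the set of displayed triples. A triple set is consistent if some rooted tree displays all its triples. $L_R$ is the set of leaves appearing in $R$. $\mathrm{cl}(R)=\bigcap\mathcal R(T)$ over all rooted trees $T$ with leaf set $L_R$ displaying $R$. For $\mathcal L\subseteq L_R$, the Ahograph $[R,\mathcal L]$ has vertex set $\mathcal L$, distinct $x,y\in\mathcal L$ adjacent iff some $xy|z\in R$ has $z\in\mathcal L$; connected components are identified with vertex sets. For a triple $ab|c$ with $a,b,c\in L_R$, $\mathfrak L(ab|c;R)$ is the set of all unordered pairs $\{A,B\}$ with $A,B\subseteq L_R$ such that $[R,A\cup B]$ has exactly two connected components, $A$ and $B$, one containing $a$ and $b$ and the other containing $c$. -}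

module Defs where

open import Data.Nat using (ℕ)
open import Data.List using (List; []; _∷_; _++_)
open import Data.List.Relation.Unary.Any using (Any)
open import Data.List.Relation.Unary.All using (All)
open import Data.List.Membership.Propositional using (_∈_)
open import Data.List.Relation.Unary.Unique.Propositional using (Unique)
open import Data.Product using (Σ; ∃; _×_; _,_)
open import Data.Sum using (_⊎_)
open import Data.Empty using (⊥)
open import Relation.Nullary using (¬_)
open import Relation.Binary.PropositionalEquality using (_≡_; _≢_)
open import Relation.Binary.Construct.Closure.ReflexiveTransitive using (Star)
open import Level using (0ℓ)
open import Relation.Unary using (Pred; _⊆_; _∪_)

Leaf : Set
Leaf = ℕ

-- Triples ab|c : three distinct leaves; ab|c = ba|c is handled by
-- comparing triples up to swapping a and b (see _≈T_).

record Triple : Set where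
  constructor mkTriple
  field
    a b c : Leaf
    a≢b : a ≢ b
    a≢c : a ≢ c
    b≢c : b ≢ c
open Triple public

Is : Leaf → Leaf → Leaf → Triple → Set
Is x y z t = ((a t ≡ x × b t ≡ y) ⊎ (a t ≡ y × b t ≡ x)) × c t ≡ z

_≈T_ : Triple → Triple → Set
t ≈T s = Is (a t) (b t) (c t) s

TripleSet : Set
TripleSet = List Triple

_∈R_ : Triple → TripleSet → Set
t ∈R R = Any (t ≈T_) R

L : TripleSet → Pred Leaf 0ℓ
L R x = Any (λ t → x ≡ a t ⊎ x ≡ b t ⊎ x ≡ c t) R

data Tree : Set where
  leaf : Leaf → Tree
  node : List Tree → Tree

mutual
  leaves : Tree → List Leaf
  leaves (leaf x)  = x ∷ []
  leaves (node ts) = leavesL ts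

  leavesL : List Tree → List Leaf
  leavesL []       = []
  leavesL (t ∷ ts) = leaves t ++ leavesL ts

-- Non-root inner vertices have degree ≥ 3, i.e. at least two children.
mutual
  NonRootOK : Tree → Set
  NonRootOK (leaf x)  = Data.Unit.⊤
    where import Data.Unit
  NonRootOK (node []) = ⊥
  NonRootOK (node (_ ∷ [])) = ⊥
  NonRootOK (node ts@(_ ∷ _ ∷ _)) = AllOK ts

  AllOK : List Tree → Set
  AllOK []       = Data.Unit.⊤
    where import Data.Unit
  AllOK (t ∷ ts) = NonRootOK t × AllOK ts

IsRootedTree : Tree → Set
IsRootedTree (leaf _)  = ⊥
IsRootedTree (node ts) = AllOK ts × Unique (leaves (node ts))

-- S is (the subtree rooted at) a vertex of T
data _⊑_ : Tree → Tree → Set where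
  here  : ∀ {T} → T ⊑ T
  there : ∀ {S U ts} → U ∈ ts → S ⊑ U → S ⊑ node ts

-- T displays ab|c: a,b,c are leaves of T and the path a–b avoids the
-- path c–root, i.e. some vertex v has a,b below it but not c
-- (v = lca(a,b)).
Displays : Tree → Triple → Set
Displays T t =
  a t ∈ leaves T × b t ∈ leaves T × c t ∈ leaves T ×
  Σ Tree (λ S → S ⊑ T × a t ∈ leaves S × b t ∈ leaves S × ¬ (c t ∈ leaves S))

DisplaysAll : Tree → TripleSet → Set
DisplaysAll T R = ∀ t → t ∈R R → Displays T t

HasLeafSet : Tree → Pred Leaf 0ℓ → Set
HasLeafSet T X = ∀ x → (x ∈ leaves T → X x) × (X x → x ∈ leaves T)

Consistent : TripleSet → Set
Consistent R = Σ Tree (λ T → IsRootedTree T × DisplaysAll T R)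

_∈cl_ : Triple → TripleSet → Set
t ∈cl R = ∀ T → IsRootedTree T → HasLeafSet T (L R) → DisplaysAll T R → Displays T t

Edge : TripleSet → Pred Leaf 0ℓ → Leaf → Leaf → Set
Edge R 𝓛 x y = x ≢ y × 𝓛 x × 𝓛 y × Σ Leaf (λ z → 𝓛 z × Any (Is x y z) R)

Connected : TripleSet → Pred Leaf 0ℓ → Leaf → Leaf → Set
Connected R 𝓛 = Star (Edge R 𝓛)

IsComponent : TripleSet → Pred Leaf 0ℓ → Pred Leaf 0ℓ → Set
IsComponent R 𝓛 C =
  (Σ Leaf C) × C ⊆ 𝓛 ×
  (∀ {x y} → C x → C y → Connected R 𝓛 x y) ×
  (∀ {x y} → C x → Connected R 𝓛 x y → C y)

Disjoint : Pred Leaf 0ℓ → Pred Leaf 0ℓ → Set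
Disjoint A B = ∀ x → ¬ (A x × B x)

TwoComponents : TripleSet → Pred Leaf 0ℓ → Pred Leaf 0ℓ → Set
TwoComponents R A B =
  IsComponent R (A ∪ B) A × IsComponent R (A ∪ B) B × Disjoint A B

-- {A,B} ∈ 𝔏(t;R)   (symmetric in A and B, i.e. an unordered pair)
InL : Triple → TripleSet → Pred Leaf 0ℓ → Pred Leaf 0ℓ → Set
InL t R A B =
  A ⊆ L R × B ⊆ L R × TwoComponents R A B ×
  ((A (a t) × A (b t) × B (c t)) ⊎ (B (a t) × B (b t) × A (c t)))

module Submission where

-- Fix a rooted tree T displaying R (it exists by consistency); its
-- leaf labels are distinct, so the vertices of T form a laminar family: two
-- vertices sharing a leaf are nested.  An Aho edge xy of [R, X] with witness
-- z ∈ X is realised in T by a vertex containing x and y but not z.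
-- A "split" of X at a leaf y is a vertex containing X with a child that contains
-- y but not all of X.  Every vertex meeting that child and missing a point of X
-- lies below the child, so the child is closed under the edges of [R, X] and
-- contains the whole component of y.  Splits exist up to double negation, which
-- suffices because everything we extract from T is a negative statement.
-- For {A,B} with y ∈ A ∩ A′ and w ∈ B ∩ B′, the splits of A ∪ B at y and at w
-- give disjoint vertices M ⊇ A and N ⊇ B, and the splits of A′ ∪ B′ give
-- vertices below M and N containing A′ and B′.  Disjoint vertices containing
-- A ∪ A′ and B ∪ B′ forbid every edge between these sets; since each of them is
-- a connected union of two overlapping components, they are the two components
-- of [R, A ∪ A′ ∪ B ∪ B′], and the orientations of t and t′ are inherited.

open import Defs
open import Function using (_∘_; id)
open import Data.Product using (Σ; _×_; _,_)
open import Data.Sum using (_⊎_; inj₁; inj₂; [_,_]′)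
import Data.Sum as Sum
open import Data.Empty using (⊥; ⊥-elim)
open import Data.List using (List; []; _∷_; _++_)
open import Data.List.Relation.Unary.Any using (Any; here; there)
import Data.List.Relation.Unary.Any as Any
import Data.List.Relation.Unary.All as All
import Data.List.Relation.Unary.All.Properties as All
open import Data.List.Relation.Unary.AllPairs using ([]; _∷_)
open import Data.List.Membership.Propositional using (_∈_)
open import Data.List.Membership.Propositional.Properties using (∈-++⁺ˡ; ∈-++⁺ʳ; ∈-++⁻)
open import Data.List.Relation.Unary.Unique.Propositional using (Unique)
open import Relation.Nullary using (¬_; yes; no)
open import Relation.Nullary.Decidable using (¬¬-excluded-middle)
open import Relation.Binary.Core using (Rel)
open import Relation.Binary.PropositionalEquality using (_≡_; _≢_; refl; sym)
open import Relation.Binary.Construct.Closure.ReflexiveTransitive using (Star; _◅◅_)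
import Relation.Binary.Construct.Closure.ReflexiveTransitive as Star
open import Level using (0ℓ)
open import Relation.Unary using (Pred; _⊆_; _∪_)

unique-++ˡ : ∀ (xs : List Leaf) {ys} → Unique (xs ++ ys) → Unique xs
unique-++ˡ []       _              = []
unique-++ˡ (x ∷ xs) (x∉ ∷ unique) = All.++⁻ˡ xs x∉ ∷ unique-++ˡ xs unique

unique-++ʳ : ∀ (xs : List Leaf) {ys} → Unique (xs ++ ys) → Unique ys
unique-++ʳ []       unique        = unique
unique-++ʳ (x ∷ xs) (_ ∷ unique) = unique-++ʳ xs unique

unique-++-disjoint : ∀ (xs : List Leaf) {ys v} → Unique (xs ++ ys) → v ∈ xs → ¬ v ∈ ys
unique-++-disjoint (x ∷ xs) (x∉ ∷ _)      (here refl) v∈ys = All.lookup x∉ (∈-++⁺ʳ xs v∈ys) refl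
unique-++-disjoint (x ∷ xs) (_ ∷ unique) (there v∈xs) v∈ys = unique-++-disjoint xs unique v∈xs v∈ys

cluster : Tree → Pred Leaf 0ℓ
cluster U x = x ∈ leaves U

child-⊑ : ∀ {U ts} → U ∈ ts → U ⊑ node ts
child-⊑ U∈ts = there U∈ts here

child-⊆ : ∀ {U ts} → U ∈ ts → cluster U ⊆ cluster (node ts)
child-⊆ {ts = t ∷ ts} (here refl) x∈U = ∈-++⁺ˡ x∈U
child-⊆ {ts = t ∷ ts} (there U∈ts) x∈U = ∈-++⁺ʳ (leaves t) (child-⊆ U∈ts x∈U)

⊑-⊆ : ∀ {S U} → S ⊑ U → cluster S ⊆ cluster U
⊑-⊆ here            = id
⊑-⊆ (there U∈ts S⊑U) = child-⊆ U∈ts ∘ ⊑-⊆ S⊑U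

⊑-trans : ∀ {S U V} → S ⊑ U → U ⊑ V → S ⊑ V
⊑-trans S⊑U here             = S⊑U
⊑-trans S⊑U (there W∈ts U⊑W) = there W∈ts (⊑-trans S⊑U U⊑W)

unique-child : ∀ {U ts} → Unique (leavesL ts) → U ∈ ts → Unique (leaves U)
unique-child {ts = t ∷ ts} unique (here refl)  = unique-++ˡ (leaves t) unique
unique-child {ts = t ∷ ts} unique (there U∈ts) = unique-child (unique-++ʳ (leaves t) unique) U∈ts

unique-⊑ : ∀ {S T} → Unique (leaves T) → S ⊑ T → Unique (leaves S)
unique-⊑ unique here             = unique
unique-⊑ unique (there U∈ts S⊑U) = unique-⊑ (unique-child unique U∈ts) S⊑U

child-eq : ∀ {ts U₁ U₂ x} → Unique (leavesL ts) → U₁ ∈ ts → U₂ ∈ ts →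
  cluster U₁ x → cluster U₂ x → U₁ ≡ U₂
child-eq {t ∷ ts} _ (here refl) (here refl) _ _ = refl
child-eq {t ∷ ts} unique (here refl) (there U₂∈) x∈U₁ x∈U₂ =
  ⊥-elim (unique-++-disjoint (leaves t) unique x∈U₁ (child-⊆ U₂∈ x∈U₂))
child-eq {t ∷ ts} unique (there U₁∈) (here refl) x∈U₁ x∈U₂ =
  ⊥-elim (unique-++-disjoint (leaves t) unique x∈U₂ (child-⊆ U₁∈ x∈U₁))
child-eq {t ∷ ts} unique (there U₁∈) (there U₂∈) x∈U₁ x∈U₂ =
  child-eq (unique-++ʳ (leaves t) unique) U₁∈ U₂∈ x∈U₁ x∈U₂

laminar : ∀ {T S P x} → Unique (leaves T) → S ⊑ T → P ⊑ T →
  cluster S x → cluster P x → S ⊑ P ⊎ P ⊑ S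
laminar _ here P⊑T _ _ = inj₂ P⊑T
laminar _ (there U∈ S⊑U) here _ _ = inj₁ (there U∈ S⊑U)
laminar unique (there U₁∈ S⊑U₁) (there U₂∈ P⊑U₂) x∈S x∈P
  with child-eq unique U₁∈ U₂∈ (⊑-⊆ S⊑U₁ x∈S) (⊑-⊆ P⊑U₂ x∈P)
... | refl = laminar (unique-child unique U₁∈) S⊑U₁ P⊑U₂ x∈S x∈P

rooted-unique : ∀ {T} → IsRootedTree T → Unique (leaves T)
rooted-unique {node _} (_ , unique) = unique

member : ∀ {P : Triple → Set} {R : TripleSet} → Any P R → Σ Triple λ t → t ∈R R × P t
member (here {x = t} Pt) = t , here ((inj₁ (refl , refl)) , refl) , Pt
member (there P∈R) with member P∈R
... | t , t∈R , Pt = t , there t∈R , Pt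

leaves-of-R : ∀ {R T} → DisplaysAll T R → L R ⊆ cluster T
leaves-of-R displays x∈L with member x∈L
... | t , t∈R , x∈t with displays t t∈R | x∈t
... | a∈T , _ , _ , _ | inj₁ refl        = a∈T
... | _ , b∈T , _ , _ | inj₂ (inj₁ refl) = b∈T
... | _ , _ , c∈T , _ | inj₂ (inj₂ refl) = c∈T

edge-sym : ∀ {R X x y} → Edge R X x y → Edge R X y x
edge-sym (x≢y , Xx , Xy , z , Xz , xy|z) =
  x≢y ∘ sym , Xy , Xx , z , Xz , Any.map (λ { (xy , c≡z) → Sum.swap xy , c≡z }) xy|z

edge-mono : ∀ {R X Y} → X ⊆ Y → ∀ {x y} → Edge R X x y → Edge R Y x y
edge-mono X⊆Y (x≢y , Xx , Xy , z , Xz , xy|z) = x≢y , X⊆Y Xx , X⊆Y Xy , z , X⊆Y Xz , xy|z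

connected-mono : ∀ {R X Y} → X ⊆ Y → ∀ {x y} → Connected R X x y → Connected R Y x y
connected-mono X⊆Y = Star.map (edge-mono X⊆Y)

preserved : ∀ {E : Rel Leaf 0ℓ} (Q : Pred Leaf 0ℓ) →
  (∀ {x y} → E x y → Q x → Q y) → ∀ {x y} → Q x → Star E x y → Q y
preserved Q step Qx path = Star.fold (λ x y → Q x → Q y) (λ e k → k ∘ step e) id path Qx

Linked : TripleSet → Pred Leaf 0ℓ → Pred Leaf 0ℓ → Set
Linked R X C = ∀ {x y} → C x → C y → Connected R X x y

union-linked : ∀ {R X X₁ X₂ C₁ C₂ y} → X₁ ⊆ X → X₂ ⊆ X →
  Linked R X₁ C₁ → Linked R X₂ C₂ → C₁ y → C₂ y → Linked R X (C₁ ∪ C₂)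
union-linked {R} {X} {C₁ = C₁} {C₂ = C₂} X₁⊆ X₂⊆ linked₁ linked₂ y₁ y₂ = λ
  { (inj₁ x) (inj₁ x′) → in₁ x x′
  ; (inj₂ x) (inj₂ x′) → in₂ x x′
  ; (inj₁ x) (inj₂ x′) → in₁ x y₁ ◅◅ in₂ y₂ x′
  ; (inj₂ x) (inj₁ x′) → in₂ x y₂ ◅◅ in₁ y₁ x′ }
  where
  in₁ : Linked R X C₁
  in₁ x x′ = connected-mono X₁⊆ (linked₁ x x′)
  in₂ : Linked R X C₂
  in₂ x x′ = connected-mono X₂⊆ (linked₂ x x′)

two-components : ∀ {R C D} → Σ Leaf C → Σ Leaf D →
  Linked R (C ∪ D) C → Linked R (C ∪ D) D →
  (∀ {x x′} → Edge R (C ∪ D) x x′ → C x → ¬ D x′) → Disjoint C D →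
  TwoComponents R C D
two-components {R} {C} {D} inhabitedC inhabitedD linkedC linkedD no-edge disjoint =
  (inhabitedC , inj₁ , linkedC , preserved C stayC) ,
  (inhabitedD , inj₂ , linkedD , preserved D stayD) ,
  disjoint
  where
  stayC : ∀ {x x′} → Edge R (C ∪ D) x x′ → C x → C x′
  stayC e@(_ , _ , x′∈ , _) Cx = [ id , (λ Dx′ → ⊥-elim (no-edge e Cx Dx′)) ]′ x′∈
  stayD : ∀ {x x′} → Edge R (C ∪ D) x x′ → D x → D x′
  stayD e@(_ , _ , x′∈ , _) Dx = [ (λ Cx′ → ⊥-elim (no-edge (edge-sym e) Cx′ Dx)) , id ]′ x′∈

not-below-leaf : ∀ {X : Pred Leaf 0ℓ} {y w} → X y → X w → y ≢ w →
  ∀ x → ¬ (X ⊆ cluster (leaf x))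
not-below-leaf Xy Xw y≢w x X⊆x with X⊆x Xy | X⊆x Xw
... | here refl | here refl = y≢w refl

module InTree {R : TripleSet} {T : Tree}
  (unique : Unique (leaves T)) (displays : DisplaysAll T R) where

  record Realisation (X : Pred Leaf 0ℓ) (x y : Leaf) : Set where
    field
      vertex    : Tree
      vertex⊑T  : vertex ⊑ T
      x-below   : cluster vertex x
      y-below   : cluster vertex y
      witness   : Leaf
      witness∈X : X witness
      witness-above : ¬ cluster vertex witness

  edge-realised : ∀ {X x y} → Edge R X x y → Realisation X x y
  edge-realised (_ , _ , _ , z , Xz , xy|z) with member xy|z
  ... | t , t∈R , (xy , refl) with displays t t∈R | xy
  ... | _ , _ , _ , S , S⊑T , aS , bS , c∉S | inj₁ (refl , refl) =
    record { vertex = S ; vertex⊑T = S⊑T ; x-below = aS ; y-below = bS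
           ; witness = c t ; witness∈X = Xz ; witness-above = c∉S }
  ... | _ , _ , _ , S , S⊑T , aS , bS , c∉S | inj₂ (refl , refl) =
    record { vertex = S ; vertex⊑T = S⊑T ; x-below = bS ; y-below = aS
           ; witness = c t ; witness∈X = Xz ; witness-above = c∉S }

  record Split (X : Pred Leaf 0ℓ) (y : Leaf) : Set where
    field
      children     : List Tree
      parent⊑T     : node children ⊑ T
      parent-full  : X ⊆ cluster (node children)
      child        : Tree
      child∈       : child ∈ children
      y∈child      : cluster child y
      child-partial : ¬ (X ⊆ cluster child)

  module _ {X : Pred Leaf 0ℓ} {y : Leaf} (not-a-leaf : ∀ x → ¬ (X ⊆ cluster (leaf x))) where
    mutual
      descend : ∀ U → U ⊑ T → X ⊆ cluster U → cluster U y → ¬ ¬ Split X y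
      descend (leaf x)  _   full _   _ = not-a-leaf x full
      descend (node us) U⊑T full y∈U   = scan us id U⊑T full y∈U

      scan : ∀ {us} vs → (∀ {v} → v ∈ vs → v ∈ us) → node us ⊑ T →
        X ⊆ cluster (node us) → y ∈ leavesL vs → ¬ ¬ Split X y
      scan (v ∷ vs) vs⊆us U⊑T full y∈vs with ∈-++⁻ (leaves v) y∈vs
      ... | inj₂ y∈rest = scan vs (vs⊆us ∘ there) U⊑T full y∈rest
      ... | inj₁ y∈v = λ no-split → ¬¬-excluded-middle {A = X ⊆ cluster v} λ
        { (yes full-v) →
            descend v (⊑-trans (child-⊑ (vs⊆us (here refl))) U⊑T) full-v y∈v no-split
        ; (no partial-v) → no-split record
            { children = _ ; parent⊑T = U⊑T ; parent-full = full ; child = v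
            ; child∈ = vs⊆us (here refl) ; y∈child = y∈v ; child-partial = partial-v } }

  split-exists : ∀ {X : Pred Leaf 0ℓ} {y w} → X ⊆ L R → X y → X w → y ≢ w → ¬ ¬ Split X y
  split-exists X⊆L Xy Xw y≢w =
    descend (not-below-leaf Xy Xw y≢w) T here (leaves-of-R displays ∘ X⊆L)
      (leaves-of-R displays (X⊆L Xy))

  module SplitFacts {X : Pred Leaf 0ℓ} {y : Leaf} (s : Split X y) where
    open Split s

    child⊑T : child ⊑ T
    child⊑T = ⊑-trans (child-⊑ child∈) parent⊑T

    below-child : ∀ {S u} → S ⊑ T → cluster S u → cluster child u →
      ¬ (X ⊆ cluster S) → S ⊑ child
    below-child S⊑T u∈S u∈child partial
      with laminar unique S⊑T parent⊑T u∈S (child-⊆ child∈ u∈child)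
    ... | inj₂ parent⊑S = ⊥-elim (partial (⊑-⊆ parent⊑S ∘ parent-full))
    ... | inj₁ here     = ⊥-elim (partial parent-full)
    ... | inj₁ (there v∈ S⊑v)
      with child-eq (unique-⊑ unique parent⊑T) v∈ child∈ (⊑-⊆ S⊑v u∈S) u∈child
    ...   | refl = S⊑v

    edge-stays : ∀ {u u′} → Edge R X u u′ → cluster child u → cluster child u′
    edge-stays e u∈child = ⊑-⊆ (below-child vertex⊑T x-below u∈child missing) y-below
      where
      open Realisation (edge-realised e)
      missing : ¬ (X ⊆ cluster vertex)
      missing full = witness-above (full witness∈X)

    component-below : ∀ {C} → IsComponent R X C → C y → C ⊆ cluster child
    component-below (_ , _ , linked , _) Cy Cx =
      preserved (cluster child) edge-stays y∈child (linked Cy Cx)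

  open Split using (child)
  open SplitFacts using (child⊑T; below-child; component-below)

  splits-apart : ∀ {A B y w} → TwoComponents R A B → A y → B w →
    (sy : Split (A ∪ B) y) (sw : Split (A ∪ B) w) →
    ∀ {v} → cluster (child sy) v → ¬ cluster (child sw) v
  splits-apart (compA , compB , _) Ay Bw sy sw v∈y v∈w
    with laminar unique (child⊑T sy) (child⊑T sw) v∈y v∈w
  ... | inj₁ y⊑w = Split.child-partial sw
    [ ⊑-⊆ y⊑w ∘ component-below sy compA Ay , component-below sw compB Bw ]′
  ... | inj₂ w⊑y = Split.child-partial sy
    [ component-below sy compA Ay , ⊑-⊆ w⊑y ∘ component-below sw compB Bw ]′

  record Separated (C D : Pred Leaf 0ℓ) : Set where
    field
      left right : Tree
      left⊑T     : left ⊑ T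
      right⊑T    : right ⊑ T
      C-below    : C ⊆ cluster left
      D-below    : D ⊆ cluster right
      apart      : ∀ {v} → cluster left v → ¬ cluster right v

  separated-disjoint : ∀ {C D} → Separated C D → Disjoint C D
  separated-disjoint sep _ (Cx , Dx) = apart (C-below Cx) (D-below Dx)
    where open Separated sep

  -- ... and no edge of [R, C ∪ D] joins them: the realising vertex would lie
  -- above both separating vertices, hence above its own witness.
  separated-no-edge : ∀ {C D x x′} → Separated C D →
    Edge R (C ∪ D) x x′ → C x → ¬ D x′
  separated-no-edge sep e Cx Dx′ = nested-impossible
    (laminar unique vertex⊑T left⊑T x-below (C-below Cx))
    (laminar unique vertex⊑T right⊑T y-below (D-below Dx′))
    where
    open Separated sep
    open Realisation (edge-realised e)
    nested-impossible : vertex ⊑ left ⊎ left ⊑ vertex → vertex ⊑ right ⊎ right ⊑ vertex → ⊥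
    nested-impossible (inj₁ v⊑l) _ = apart (⊑-⊆ v⊑l y-below) (D-below Dx′)
    nested-impossible (inj₂ _) (inj₁ v⊑r) = apart (C-below Cx) (⊑-⊆ v⊑r x-below)
    nested-impossible (inj₂ l⊑v) (inj₂ r⊑v) =
      witness-above ([ (λ Cz → ⊑-⊆ l⊑v (C-below Cz)) , (λ Dz → ⊑-⊆ r⊑v (D-below Dz)) ]′ witness∈X)

  -- Two pairs of components meeting in y and w are separated in T: the splits
  -- of A′ ∪ B′ lie below the corresponding splits of A ∪ B.
  merge-separated : ∀ {A B A′ B′ y w} → TwoComponents R A B → TwoComponents R A′ B′ →
    A y → A′ y → B w → B′ w →
    Split (A ∪ B) y → Split (A ∪ B) w → Split (A′ ∪ B′) y → Split (A′ ∪ B′) w →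
    Separated (A ∪ A′) (B ∪ B′)
  merge-separated {y = y} {w = w}
    AB@(compA , compB , _) A′B′@(compA′ , compB′ , _) Ay A′y Bw B′w sy sw s′y s′w =
    record { left = child sy ; right = child sw
           ; left⊑T = child⊑T sy ; right⊑T = child⊑T sw
           ; C-below = [ component-below sy compA Ay , ⊑-⊆ s′y⊑sy ∘ component-below s′y compA′ A′y ]′
           ; D-below = [ component-below sw compB Bw , ⊑-⊆ s′w⊑sw ∘ component-below s′w compB′ B′w ]′
           ; apart = splits-apart AB Ay Bw sy sw }
    where
    w∉s′y : ¬ cluster (child s′y) w
    w∉s′y w∈ = splits-apart A′B′ A′y B′w s′y s′w w∈ (component-below s′w compB′ B′w B′w)
    y∉s′w : ¬ cluster (child s′w) y
    y∉s′w y∈ = splits-apart A′B′ A′y B′w s′y s′w (component-below s′y compA′ A′y A′y) y∈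
    s′y⊑sy : child s′y ⊑ child sy
    s′y⊑sy = below-child sy (child⊑T s′y) (Split.y∈child s′y) (Split.y∈child sy)
      (λ full → w∉s′y (full (inj₂ Bw)))
    s′w⊑sw : child s′w ⊑ child sw
    s′w⊑sw = below-child sw (child⊑T s′w) (Split.y∈child s′w) (Split.y∈child sw)
      (λ full → y∉s′w (full (inj₁ Ay)))

  merged-components : ∀ {A B A′ B′ y w} → A ∪ B ⊆ L R → A′ ∪ B′ ⊆ L R →
    TwoComponents R A B → TwoComponents R A′ B′ → A y → A′ y → B w → B′ w →
    TwoComponents R (A ∪ A′) (B ∪ B′)
  merged-components {A} {B} {A′} {B′} {y} {w} AB⊆L A′B′⊆L
    AB@((_ , _ , linkedA , _) , (_ , _ , linkedB , _) , disjoint)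
    A′B′@((_ , _ , linkedA′ , _) , (_ , _ , linkedB′ , _) , _) Ay A′y Bw B′w =
    two-components (y , inj₁ Ay) (w , inj₁ Bw)
      (union-linked left-graph right-graph linkedA linkedA′ Ay A′y)
      (union-linked left-graph right-graph linkedB linkedB′ Bw B′w)
      (λ e Cx Dx′ → separated λ sep → separated-no-edge sep e Cx Dx′)
      (λ x CDx → separated λ sep → separated-disjoint sep x CDx)
    where
    left-graph : A ∪ B ⊆ (A ∪ A′) ∪ (B ∪ B′)
    left-graph = Sum.map inj₁ inj₁
    right-graph : A′ ∪ B′ ⊆ (A ∪ A′) ∪ (B ∪ B′)
    right-graph = Sum.map inj₂ inj₂
    y≢w : y ≢ w
    y≢w refl = disjoint y (Ay , Bw)
    separated : ¬ ¬ Separated (A ∪ A′) (B ∪ B′)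
    separated no-sep =
      split-exists AB⊆L (inj₁ Ay) (inj₂ Bw) y≢w λ sy →
      split-exists AB⊆L (inj₂ Bw) (inj₁ Ay) (y≢w ∘ sym) λ sw →
      split-exists A′B′⊆L (inj₁ A′y) (inj₂ B′w) y≢w λ s′y →
      split-exists A′B′⊆L (inj₂ B′w) (inj₁ A′y) (y≢w ∘ sym) λ s′w →
      no-sep (merge-separated AB A′B′ Ay A′y Bw B′w sy sw s′y s′w)

Oriented : Triple → Pred Leaf 0ℓ → Pred Leaf 0ℓ → Set
Oriented t A B = (A (a t) × A (b t) × B (c t)) ⊎ (B (a t) × B (b t) × A (c t))

oriented-mono : ∀ {t A B C D} → A ⊆ C → B ⊆ D → Oriented t A B → Oriented t C D
oriented-mono A⊆C B⊆D (inj₁ (Aa , Ab , Bc)) = inj₁ (A⊆C Aa , A⊆C Ab , B⊆D Bc)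
oriented-mono A⊆C B⊆D (inj₂ (Ba , Bb , Ac)) = inj₂ (B⊆D Ba , B⊆D Bb , A⊆C Ac)

mainTheorem13 : (R : TripleSet) → Consistent R →
    (t t′ : Triple) → t ∈cl R → t′ ∈cl R →
    ∀ A B A′ B′ → InL t R A B → InL t′ R A′ B′ →
    Σ Leaf (λ x → A x × A′ x) → Σ Leaf (λ x → B x × B′ x) →
    InL t R (A ∪ A′) (B ∪ B′) × InL t′ R (A ∪ A′) (B ∪ B′)
mainTheorem13 R (T , rooted , displays) t t′ _ _ A B A′ B′
  (A⊆L , B⊆L , AB , orient) (A′⊆L , B′⊆L , A′B′ , orient′) (y , Ay , A′y) (w , Bw , B′w) =
  (AA′⊆L , BB′⊆L , merged , oriented-mono {t} {A} {B} {A ∪ A′} {B ∪ B′} inj₁ inj₁ orient) ,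
  (AA′⊆L , BB′⊆L , merged , oriented-mono {t′} {A′} {B′} {A ∪ A′} {B ∪ B′} inj₂ inj₂ orient′)
  where
  open InTree (rooted-unique rooted) displays
  AA′⊆L : A ∪ A′ ⊆ L R
  AA′⊆L = [ A⊆L , A′⊆L ]′
  BB′⊆L : B ∪ B′ ⊆ L R
  BB′⊆L = [ B⊆L , B′⊆L ]′
  merged : TwoComponents R (A ∪ A′) (B ∪ B′)
  merged = merged-components [ A⊆L , B⊆L ]′ [ A′⊆L , B′⊆L ]′ AB A′B′ Ay A′y Bw B′w
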